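{- Let $k\geq 1$ and let $(v_1,v_2,\dots,v_k)$ be a partial greedy in-dominating set in a tournament $T$. Let $E$ be the set of vertices of $T$ which are not in-dominated by $\{v_1,\dots,v_k\}$. Then every $u\in E$ satisfies $d^+(u)\geq 2^{k-1}|E|$.
   Context: A tournament is a directed graph with exactly one directed edge between any two distinct vertices. For a vertex $v$, $N^+(v)$ is the set of vertices $u$ with $vu$ an edge, $N^-(v)$ the set of $u$ with $uv$ an edge, $d^+(v)=|N^+(v)|$ and $d^-(v)=|N^-(v)|$ (degrees taken in $T$). A set $S$ of vertices in-dominates a set $B$ if for every $b\in B\setminus S$ there is some $s\in S$ such that $bs$ is an edge; a vertex $u$ is in-dominated by $S$ if $\{u\}$ is in-dominated by $S$ (i.e. $u\in S$ or $us$ is an edge for some $s\in S$). A sequence $(v_1,\dots,v_k)$ of vertices of $T$ is a partial greedy in-dominating set if $v_1$ is a vertex of maximum in-degree in $T$, and for each $i\geq 2$, $v_i$ is a vertex of maximum in-degree in the subtournament of $T$ induced on $N^+(v_1)\cap N^+(v_2)\cap\dots\cap N^+(v_{i-1})$. -}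

module Defs where

open import Data.Nat using (ℕ; zero; suc; _+_; _≤_; _<ᵇ_)
open import Data.Bool using (Bool; true; false; not; _∧_; _∨_; if_then_else_)
open import Data.Fin using (Fin; toℕ; _≟_)
open import Data.List using (List; foldr; map)
open import Data.Bool.ListAction using (and)
open import Data.Product using (_×_)
open import Data.List.Base using (allFin)
open import Relation.Nullary.Decidable using (⌊_⌋)
open import Relation.Binary.PropositionalEquality using (_≡_; _≢_)

record Tournament (n : ℕ) : Set where
  field
    adj     : Fin n → Fin n → Bool
    irrefl  : ∀ u → adj u u ≡ false
    tourney : ∀ u v → u ≢ v → adj u v ≡ not (adj v u)
open Tournament public

VSet : ℕ → Set
VSet n = Fin n → Bool

card : ∀ {n} → VSet n → ℕ
card {n} S = foldr (λ u acc → (if S u then 1 else 0) + acc) 0 (allFin n)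

outdeg : ∀ {n} → Tournament n → Fin n → ℕ
outdeg T v = card (λ u → adj T v u)

indegIn : ∀ {n} → Tournament n → VSet n → Fin n → ℕ
indegIn T S v = card (λ u → S u ∧ adj T u v)

IsMaxIndegIn : ∀ {n} → Tournament n → VSet n → Fin n → Set
IsMaxIndegIn T S v = (S v ≡ true) × (∀ u → S u ≡ true → indegIn T S u ≤ indegIn T S v)

-- common out-neighbourhood N^+(v_1) ∩ ... ∩ N^+(v_{i-1}) of the vertices
-- v j with j < i (the whole vertex set when i is the first index)
CommonOut : ∀ {n k} → Tournament n → (Fin k → Fin n) → Fin k → VSet n
CommonOut {k = k} T vs i u =
  and (map (λ j → if toℕ j <ᵇ toℕ i then adj T (vs j) u else true) (allFin k))

IsPartialGreedy : ∀ {n k} → Tournament n → (Fin k → Fin n) → Set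
IsPartialGreedy T vs = ∀ i → IsMaxIndegIn T (CommonOut T vs i) (vs i)

InDominated : ∀ {n k} → Tournament n → (Fin k → Fin n) → Fin n → Bool
InDominated {k = k} T vs u =
  foldr _∨_ false (map (λ j → ⌊ u ≟ vs j ⌋ ∨ adj T u (vs j)) (allFin k))

NotDominated : ∀ {n k} → Tournament n → (Fin k → Fin n) → VSet n
NotDominated T vs u = not (InDominated T vs u)

-- Write C_t for the common out-neighbourhood of v_1, …, v_t (C_0 = V(T)), so that E = C_k and
-- C_{t+1} = N^+(v_{t+1}) ∩ C_t.  A vertex of maximum in-degree in a tournament on s vertices has
-- out-degree at most its in-degree (average the in-degrees), hence less than s/2; so greedily
-- choosing v_{t+1} gives 2|C_{t+1}| ≤ |C_t|, and iterating, 2^{k-1}|C_k| ≤ |C_1| = d^+(v_1).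
-- Finally v_1 has maximum in-degree, hence minimum out-degree, in T.
module Submission where

open import Defs
open import Data.Nat using (ℕ; zero; suc; _*_; _^_; _≤_; _<_; _+_; _<ᵇ_; z≤n)
open import Data.Nat.Properties
  using (+-*-semiring; +-comm; *-assoc; *-comm; *-identityˡ; *-monoʳ-≤; +-mono-≤;
         +-monoˡ-≤; +-monoʳ-≤; +-cancelˡ-≤; *-cancelˡ-≤; suc-injective; ≤-refl; ≤-reflexive;
         <⇒≤; n<1+n; m≤n⇒m≤1+n; m<1+n⇒m<n∨m≡n; <⇒<ᵇ; <ᵇ⇒<; module ≤-Reasoning)
open import Data.Fin using (Fin; zero; suc; toℕ; fromℕ<; _≟_)
open import Data.Fin.Properties using (toℕ-fromℕ<; toℕ-injective; toℕ<n)
open import Data.Bool using (Bool; true; false; not; _∧_; _∨_; if_then_else_; T)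
open import Data.Bool.Properties using (T-≡; T-∧; ⇔→≡)
open import Data.Bool.ListAction using (all; any)
open import Data.List using ([]; _∷_; foldr; tabulate; allFin)
open import Data.List.Properties using (map-cong)
open import Data.List.Relation.Unary.All.Properties using (all⁺; all⁻; tabulate⁺; tabulate⁻)
open import Data.Product using (_,_; proj₁; proj₂)
open import Data.Sum using (inj₁; inj₂)
open import Function using (_∘_; id; _⇔_; mk⇔; Equivalence)
open import Relation.Nullary using (yes; no)
open import Relation.Nullary.Decidable using (⌊_⌋)
open import Relation.Binary.PropositionalEquality
  using (_≡_; refl; sym; trans; cong; cong₂; subst; module ≡-Reasoning)
open import Algebra.Properties.Semiring.Sum +-*-semiring
  using (sum; sum-syntax; sum-cong-≗; sum-replicate-zero; ∑-distrib-+; ∑-comm;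
         *-distribˡ-sum; *-distribʳ-sum)

open Equivalence using (to; from)

private
  variable
    n k : ℕ

𝟙 : Bool → ℕ
𝟙 b = if b then 1 else 0

card≡∑ : (S : VSet n) → card S ≡ ∑[ u < n ] 𝟙 (S u)
card≡∑ {n} S = foldr-tabulate id
  where
  foldr-tabulate : ∀ {m} (f : Fin m → Fin n) →
    foldr (λ u acc → 𝟙 (S u) + acc) 0 (tabulate f) ≡ ∑[ i < m ] 𝟙 (S (f i))
  foldr-tabulate {zero}  f = refl
  foldr-tabulate {suc m} f = cong (𝟙 (S (f zero)) +_) (foldr-tabulate (f ∘ suc))

card-cong : {S S′ : VSet n} → (∀ u → S u ≡ S′ u) → card S ≡ card S′
card-cong {S = S} {S′} S≗S′ =
  trans (card≡∑ S) (trans (sum-cong-≗ (cong 𝟙 ∘ S≗S′)) (sym (card≡∑ S′)))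

∑-mono-≤ : {f g : Fin n → ℕ} → (∀ i → f i ≤ g i) → sum f ≤ sum g
∑-mono-≤ {zero}  f≤g = z≤n
∑-mono-≤ {suc n} f≤g = +-mono-≤ (f≤g zero) (∑-mono-≤ (f≤g ∘ suc))

⌊suc≟suc⌋ : (u v : Fin n) → ⌊ suc u ≟ suc v ⌋ ≡ ⌊ u ≟ v ⌋
⌊suc≟suc⌋ u v with u ≟ v
... | yes _ = refl
... | no  _ = refl

∑-𝟙-≟ : (v : Fin n) → ∑[ u < n ] 𝟙 ⌊ u ≟ v ⌋ ≡ 1
∑-𝟙-≟ {suc n} zero    = cong suc (sum-replicate-zero n)
∑-𝟙-≟ {suc n} (suc v) = trans (sum-cong-≗ (λ u → cong 𝟙 (⌊suc≟suc⌋ u v))) (∑-𝟙-≟ v)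

𝟙*-mono-≤ : ∀ b {x y} → (b ≡ true → x ≤ y) → 𝟙 b * x ≤ 𝟙 b * y
𝟙*-mono-≤ true  x≤y = *-monoʳ-≤ 1 (x≤y refl)
𝟙*-mono-≤ false _   = z≤n

𝟙*𝟙∧-swap : ∀ a b c → 𝟙 b * 𝟙 (a ∧ c) ≡ 𝟙 a * 𝟙 (b ∧ c)
𝟙*𝟙∧-swap true  true  c = refl
𝟙*𝟙∧-swap true  false c = refl
𝟙*𝟙∧-swap false true  c = refl
𝟙*𝟙∧-swap false false c = refl

-- Both sides count the arcs of the digraph R restricted to S.
∑-indeg≡∑-outdeg : (R : Fin n → Fin n → Bool) (S : VSet n) →
  ∑[ w < n ] (𝟙 (S w) * card (λ u → S u ∧ R u w)) ≡ ∑[ w < n ] (𝟙 (S w) * card (λ u → S u ∧ R w u))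
∑-indeg≡∑-outdeg {n} R S = begin
  ∑[ w < n ] (𝟙 (S w) * card (λ u → S u ∧ R u w))     ≡⟨ sum-cong-≗ (λ w → 𝟙*card (S w) _) ⟩
  ∑[ w < n ] ∑[ u < n ] (𝟙 (S w) * 𝟙 (S u ∧ R u w))   ≡⟨ ∑-comm (λ w u → 𝟙 (S w) * 𝟙 (S u ∧ R u w)) ⟩
  ∑[ u < n ] ∑[ w < n ] (𝟙 (S w) * 𝟙 (S u ∧ R u w))   ≡⟨ sum-cong-≗ (λ u → sum-cong-≗ (λ w →
                                                           𝟙*𝟙∧-swap (S u) (S w) (R u w))) ⟩
  ∑[ u < n ] ∑[ w < n ] (𝟙 (S u) * 𝟙 (S w ∧ R u w))   ≡⟨ sum-cong-≗ (λ u → 𝟙*card (S u) _) ⟨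
  ∑[ u < n ] (𝟙 (S u) * card (λ w → S w ∧ R u w))     ∎
  where
  open ≡-Reasoning
  𝟙*card : ∀ b (S′ : VSet n) → 𝟙 b * card S′ ≡ ∑[ u < n ] (𝟙 b * 𝟙 (S′ u))
  𝟙*card b S′ = trans (cong (𝟙 b *_) (card≡∑ S′)) (*-distribˡ-sum (𝟙 b) (𝟙 ∘ S′))

outdegIn : Tournament n → VSet n → Fin n → ℕ
outdegIn G S v = card (λ u → S u ∧ adj G v u)

module _ (G : Tournament n) (S : VSet n) where

  indegIn+outdegIn : ∀ {v} → S v ≡ true → suc (indegIn G S v + outdegIn G S v) ≡ card S
  indegIn+outdegIn {v} v∈S = begin
    suc (indegIn G S v + outdegIn G S v)
      ≡⟨ +-comm 1 _ ⟩
    indegIn G S v + outdegIn G S v + 1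
      ≡⟨ cong₂ _+_ (cong₂ _+_ (card≡∑ (λ u → S u ∧ adj G u v)) (card≡∑ (λ u → S u ∧ adj G v u)))
                   (sym (∑-𝟙-≟ v)) ⟩
    ∑[ u < n ] 𝟙 (S u ∧ adj G u v) + ∑[ u < n ] 𝟙 (S u ∧ adj G v u) + ∑[ u < n ] 𝟙 ⌊ u ≟ v ⌋
      ≡⟨ cong (_+ ∑[ u < n ] 𝟙 ⌊ u ≟ v ⌋) (∑-distrib-+ in-arc out-arc) ⟨
    ∑[ u < n ] (in-arc u + out-arc u) + ∑[ u < n ] 𝟙 ⌊ u ≟ v ⌋
      ≡⟨ ∑-distrib-+ (λ u → in-arc u + out-arc u) (λ u → 𝟙 ⌊ u ≟ v ⌋) ⟨
    ∑[ u < n ] (in-arc u + out-arc u + 𝟙 ⌊ u ≟ v ⌋)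
      ≡⟨ sum-cong-≗ split ⟩
    ∑[ u < n ] 𝟙 (S u)
      ≡⟨ card≡∑ S ⟨
    card S ∎
    where
    open ≡-Reasoning
    in-arc out-arc : Fin n → ℕ
    in-arc  u = 𝟙 (S u ∧ adj G u v)
    out-arc u = 𝟙 (S u ∧ adj G v u)
    split : ∀ u → in-arc u + out-arc u + 𝟙 ⌊ u ≟ v ⌋ ≡ 𝟙 (S u)
    split u with u ≟ v
    ... | yes refl rewrite irrefl G u | v∈S = refl
    ... | no  u≢v  rewrite tourney G u v u≢v with S u | adj G v u
    ...   | true  | true  = refl
    ...   | true  | false = refl
    ...   | false | _     = refl

  outdegIn-antitone : ∀ {u v} → S u ≡ true → S v ≡ true →
    indegIn G S u ≤ indegIn G S v → outdegIn G S v ≤ outdegIn G S u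
  outdegIn-antitone {u} {v} u∈S v∈S in≤in = +-cancelˡ-≤ (indegIn G S v) _ _ (begin
    indegIn G S v + outdegIn G S v
      ≡⟨ suc-injective (trans (indegIn+outdegIn v∈S) (sym (indegIn+outdegIn u∈S))) ⟩
    indegIn G S u + outdegIn G S u ≤⟨ +-monoˡ-≤ _ in≤in ⟩
    indegIn G S v + outdegIn G S u ∎)
    where open ≤-Reasoning

  -- Averaging: |S| d⁺(v) ≤ Σ_{w ∈ S} d⁺(w) = Σ_{w ∈ S} d⁻(w) ≤ |S| d⁻(v).
  maxIndegIn⇒outdegIn≤indegIn : ∀ {v} → IsMaxIndegIn G S v → outdegIn G S v ≤ indegIn G S v
  maxIndegIn⇒outdegIn≤indegIn {v} (v∈S , max) =
    *-cancelˡ-≤ (suc (indegIn G S v + outdegIn G S v))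
      (subst (λ c → c * outdegIn G S v ≤ c * indegIn G S v) (sym (indegIn+outdegIn v∈S)) (begin
        card S * outdegIn G S v                ≡⟨ card*≡∑ _ ⟩
        ∑[ w < n ] (𝟙 (S w) * outdegIn G S v) ≤⟨ ∑-mono-≤ (λ w → 𝟙*-mono-≤ (S w) (λ w∈S →
                                                  outdegIn-antitone w∈S v∈S (max w w∈S))) ⟩
        ∑[ w < n ] (𝟙 (S w) * outdegIn G S w) ≡⟨ ∑-indeg≡∑-outdeg (adj G) S ⟨
        ∑[ w < n ] (𝟙 (S w) * indegIn G S w)  ≤⟨ ∑-mono-≤ (λ w → 𝟙*-mono-≤ (S w) (max w)) ⟩
        ∑[ w < n ] (𝟙 (S w) * indegIn G S v)  ≡⟨ card*≡∑ _ ⟨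
        card S * indegIn G S v                 ∎))
    where
    open ≤-Reasoning
    card*≡∑ : ∀ x → card S * x ≡ ∑[ w < n ] (𝟙 (S w) * x)
    card*≡∑ x = trans (cong (_* x) (card≡∑ S)) (*-distribʳ-sum x (𝟙 ∘ S))

  maxIndegIn⇒2*outdegIn<card : ∀ {v} → IsMaxIndegIn G S v → 2 * outdegIn G S v < card S
  maxIndegIn⇒2*outdegIn<card {v} v-max@(v∈S , _) = begin-strict
    2 * outdegIn G S v                   ≡⟨ cong (outdegIn G S v +_) (+-comm _ 0) ⟩
    outdegIn G S v + outdegIn G S v      ≤⟨ +-monoʳ-≤ _ (maxIndegIn⇒outdegIn≤indegIn v-max) ⟩
    outdegIn G S v + indegIn G S v       ≡⟨ +-comm (outdegIn G S v) (indegIn G S v) ⟩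
    indegIn G S v + outdegIn G S v       <⟨ n<1+n _ ⟩
    suc (indegIn G S v + outdegIn G S v) ≡⟨ indegIn+outdegIn v∈S ⟩
    card S                               ∎
    where open ≤-Reasoning

-- CommonOut G vs i unfolds to CommonOutBelow G vs (toℕ i); the ℕ-indexed version also allows t = k.
CommonOutBelow : Tournament n → (Fin k → Fin n) → ℕ → VSet n
CommonOutBelow {k = k} G vs t u = all (λ j → if toℕ j <ᵇ t then adj G (vs j) u else true) (allFin k)

T-all-allFin : (p : Fin k → Bool) → T (all p (allFin k)) ⇔ (∀ j → T (p j))
T-all-allFin p = mk⇔ (tabulate⁻ ∘ all⁺ p _) (all⁻ p ∘ tabulate⁺)

T-injective : ∀ {x y} → (T x ⇔ T y) → x ≡ y
T-injective x⇔y = ⇔→≡ (mk⇔ (to T-≡ ∘ to x⇔y ∘ from T-≡) (to T-≡ ∘ from x⇔y ∘ from T-≡))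

not-any≡all-not : ∀ {A : Set} (p : A → Bool) xs → not (any p xs) ≡ all (not ∘ p) xs
not-any≡all-not p []       = refl
not-any≡all-not p (x ∷ xs) with p x
... | true  = refl
... | false = not-any≡all-not p xs

module _ (G : Tournament n) (vs : Fin k → Fin n) where

  private
    C : ℕ → VSet n
    C = CommonOutBelow G vs

  T-CommonOutBelow : ∀ t u → T (C t u) ⇔ (∀ j → toℕ j < t → T (adj G (vs j) u))
  T-CommonOutBelow t u = mk⇔
    (λ u∈C j j<t → T-if (to (T-all-allFin _) u∈C j) (<⇒<ᵇ j<t))
    (λ h → from (T-all-allFin _) (λ j → if-T (λ j<t → h j (<ᵇ⇒< (toℕ j) t j<t))))
    where
    T-if : ∀ {b x} → T (if b then x else true) → T b → T x
    T-if {true} x _ = x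
    if-T : ∀ {b x} → (T b → T x) → T (if b then x else true)
    if-T {true}  f = f _
    if-T {false} _ = _

  CommonOutBelow-zero : ∀ u → C 0 u ≡ true
  CommonOutBelow-zero u = to T-≡ (from (T-CommonOutBelow 0 u) (λ _ ()))

  CommonOutBelow-suc : ∀ (i : Fin k) u → C (suc (toℕ i)) u ≡ C (toℕ i) u ∧ adj G (vs i) u
  CommonOutBelow-suc i u = T-injective (mk⇔ restrict extend)
    where
    restrict : T (C (suc (toℕ i)) u) → T (C (toℕ i) u ∧ adj G (vs i) u)
    restrict u∈C′ = from T-∧ (from (T-CommonOutBelow _ u) (λ j j<i → below j (m≤n⇒m≤1+n j<i)) , below i ≤-refl)
      where
      below : ∀ j → toℕ j < suc (toℕ i) → T (adj G (vs j) u)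
      below = to (T-CommonOutBelow _ u) u∈C′
    extend : T (C (toℕ i) u ∧ adj G (vs i) u) → T (C (suc (toℕ i)) u)
    extend u∈C∧vᵢ→u with to T-∧ u∈C∧vᵢ→u
    ... | u∈C , vᵢ→u = from (T-CommonOutBelow _ u) below-or-at
      where
      below-or-at : ∀ j → toℕ j < suc (toℕ i) → T (adj G (vs j) u)
      below-or-at j j≤i with m<1+n⇒m<n∨m≡n j≤i
      ... | inj₁ j<i = to (T-CommonOutBelow _ u) u∈C j j<i
      ... | inj₂ j≡i rewrite toℕ-injective j≡i = vᵢ→u

  NotDominated≡CommonOutBelow : ∀ u → NotDominated G vs u ≡ C k u
  NotDominated≡CommonOutBelow u =
    trans (not-any≡all-not _ (allFin k)) (cong (foldr _∧_ true) (map-cong not-dominating (allFin k)))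
    where
    not-dominating : ∀ j → not (⌊ u ≟ vs j ⌋ ∨ adj G u (vs j))
                         ≡ (if toℕ j <ᵇ k then adj G (vs j) u else true)
    not-dominating j rewrite to T-≡ (<⇒<ᵇ (toℕ<n j)) with u ≟ vs j
    ... | yes refl = sym (irrefl G u)
    ... | no  u≢vⱼ = sym (tourney G (vs j) u (u≢vⱼ ∘ sym))

  card-CommonOutBelow-suc : (i : Fin k) → card (C (suc (toℕ i))) ≡ outdegIn G (C (toℕ i)) (vs i)
  card-CommonOutBelow-suc i = card-cong (CommonOutBelow-suc i)

  module _ (greedy : IsPartialGreedy G vs) where

    greedy-halving : ∀ {t} → t < k → 2 * card (C (suc t)) ≤ card (C t)
    greedy-halving t<k with fromℕ< t<k | toℕ-fromℕ< t<k
    ... | i | refl = begin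
      2 * card (C (suc (toℕ i)))         ≡⟨ cong (2 *_) (card-CommonOutBelow-suc i) ⟩
      2 * outdegIn G (C (toℕ i)) (vs i)  ≤⟨ <⇒≤ (maxIndegIn⇒2*outdegIn<card G _ (greedy i)) ⟩
      card (C (toℕ i))                   ∎
      where open ≤-Reasoning

    greedy-doubling : ∀ t → t < k → 2 ^ t * card (C (suc t)) ≤ card (C 1)
    greedy-doubling zero    _    = ≤-reflexive (*-identityˡ _)
    greedy-doubling (suc t) t<k = begin
      2 ^ suc t * card (C (suc (suc t)))   ≡⟨ cong (_* card (C (suc (suc t)))) (*-comm 2 (2 ^ t)) ⟩
      2 ^ t * 2 * card (C (suc (suc t)))   ≡⟨ *-assoc (2 ^ t) 2 (card (C (suc (suc t)))) ⟩
      2 ^ t * (2 * card (C (suc (suc t)))) ≤⟨ *-monoʳ-≤ (2 ^ t) (greedy-halving t<k) ⟩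
      2 ^ t * card (C (suc t))             ≤⟨ greedy-doubling t (<⇒≤ t<k) ⟩
      card (C 1)                           ∎
      where open ≤-Reasoning

card-CommonOutBelow-1≤outdeg : (G : Tournament n) (vs : Fin (suc k) → Fin n) →
  IsPartialGreedy G vs → ∀ u → card (CommonOutBelow G vs 1) ≤ outdeg G u
card-CommonOutBelow-1≤outdeg G vs greedy u = begin
  card (CommonOutBelow G vs 1) ≡⟨ card-CommonOutBelow-suc G vs zero ⟩
  outdegIn G V (vs zero)       ≤⟨ outdegIn-antitone G V (V-full u) (proj₁ (greedy zero))
                                                        (proj₂ (greedy zero) u (V-full u)) ⟩
  outdegIn G V u               ≡⟨ card-cong (λ x → cong (_∧ adj G u x) (V-full x)) ⟩
  outdeg G u                   ∎
  where
  open ≤-Reasoning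
  V : VSet _
  V = CommonOutBelow G vs 0
  V-full : ∀ x → V x ≡ true
  V-full = CommonOutBelow-zero G vs

lemma2p3 : ∀ {n} (T : Tournament n) (m : ℕ) (vs : Fin (suc m) → Fin n)
             → IsPartialGreedy T vs
             → ∀ u → NotDominated T vs u ≡ true
             → 2 ^ m * card (NotDominated T vs) ≤ outdeg T u
lemma2p3 T m vs greedy u _ = begin
  2 ^ m * card (NotDominated T vs)           ≡⟨ cong (2 ^ m *_) (card-cong (NotDominated≡CommonOutBelow T vs)) ⟩
  2 ^ m * card (CommonOutBelow T vs (suc m)) ≤⟨ greedy-doubling T vs greedy m (n<1+n m) ⟩
  card (CommonOutBelow T vs 1)               ≤⟨ card-CommonOutBelow-1≤outdeg T vs greedy u ⟩
  outdeg T u                                 ∎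
  where open ≤-Reasoning
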